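{- When $P=O(1)$, FCFS is $O(1)$-competitive for minimizing the $\ell_2$ norm of flow time: for every $K\ge1$ there is a constant $C_K$ such that every instance with $P\le K$ satisfies $\sqrt{F(\mathcal{FCFS})}\le C_K\sqrt{F(\mathcal{OPT})}$.
   Context: A single machine and $n$ jobs; job $J_i$ has integer release time $r_i\ge0$ and integer processing time $p_i\ge1$. Unit slots $[t]=[t,t+1)$; a (preemptive) schedule assigns each slot to at most one job so that $J_i$ receives exactly $p_i$ slots, all with $t\ge r_i$. $c_i(\mathcal{S})$ is the completion time of $J_i$, $f_i(\mathcal{S})=c_i(\mathcal{S})-r_i$, $F(\mathcal{S})=\sum_i f_i(\mathcal{S})^2$, the $\ell_2$ norm of flow time is $\sqrt{F(\mathcal{S})}$, and $\mathcal{OPT}$ minimizes $F$. $P=\max_i p_i/\min_i p_i$. $\mathcal{FCFS}$ is the First-Come-First-Served schedule: jobs are processed non-preemptively in order of non-decreasing release time, never idling while some released job is unfinished. -}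

module Defs where

open import Data.Nat using (ℕ; zero; suc; _+_; _*_; _∸_; _≤_; _<_)
open import Data.Fin using (Fin; _≟_)
open import Data.Bool using (Bool; true; false; if_then_else_)
open import Data.Maybe using (Maybe; just; nothing)
open import Data.List using (map; allFin)
open import Data.Nat.ListAction using (sum)
open import Relation.Nullary.Decidable using (⌊_⌋)
open import Relation.Binary.PropositionalEquality using (_≡_)

isJob : ∀ {n} → Maybe (Fin n) → Fin n → Bool
isJob nothing  i = false
isJob (just j) i = ⌊ j ≟ i ⌋

slotCount : ∀ {n} → (ℕ → Maybe (Fin n)) → Fin n → ℕ → ℕ
slotCount σ i zero    = 0
slotCount σ i (suc T) = (if isJob (σ T) i then 1 else 0) + slotCount σ i T

-- completion time within horizon T: 1 + last slot t < T assigned to i (0 if none)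
lastEnd : ∀ {n} → (ℕ → Maybe (Fin n)) → Fin n → ℕ → ℕ
lastEnd σ i zero    = 0
lastEnd σ i (suc T) = if isJob (σ T) i then suc T else lastEnd σ i T

-- A feasible preemptive schedule for jobs with release times r and processing
-- times p: slot t = [t,t+1) is given to at most one job (slot t), nothing is
-- scheduled from `horizon` on, job i gets exactly p i slots, all at t ≥ r i.
record Schedule (n : ℕ) (r p : Fin n → ℕ) : Set where
  field
    horizon    : ℕ
    slot       : ℕ → Maybe (Fin n)
    idle-after : ∀ t → horizon ≤ t → slot t ≡ nothing
    amount     : ∀ i → slotCount slot i horizon ≡ p i
    released   : ∀ t i → slot t ≡ just i → r i ≤ t

module _ {n : ℕ} {r p : Fin n → ℕ} (S : Schedule n r p) where
  open Schedule S

  completion : Fin n → ℕ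
  completion i = lastEnd slot i horizon

  flow : Fin n → ℕ
  flow i = completion i ∸ r i

  cost : ℕ
  cost = sum (map (λ i → flow i * flow i) (allFin n))

  -- S is a First-Come-First-Served schedule: every job is processed
  -- non-preemptively (in the p_i consecutive slots ending at c_i), jobs are
  -- processed in order of non-decreasing release time (ties in any order),
  -- and the machine never idles while some released job is unfinished.
  record IsFCFS : Set where
    field
      contiguous : ∀ i t → completion i ∸ p i ≤ t → t < completion i → slot t ≡ just i
      ordered    : ∀ i j → r i < r j → completion i ≤ completion j ∸ p j
      non-idling : ∀ t → slot t ≡ nothing → ∀ i → r i ≤ t → completion i ≤ t

-- For FCFS, a job i alive at slot u finishes within the work W(u) released and still pending at u:
-- before c_i, FCFS never idles and only runs jobs released no later than r_i. Together with
-- f_i² ≤ 2 Σ_{r_i ≤ u < c_i} (c_i − u) this gives F(FCFS) ≤ 2 Σ_u N(u) W(u), where N(u) counts the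
-- alive jobs. FCFS is work-conserving, so W(u) ≤ W′(u) ≤ K q N′(u) for every schedule S′, with q the
-- processing time of some fixed job; and at most one alive job is partially processed, so
-- q N(u) ≤ K W(u) + q. Hence N(u) W(u) ≤ (K³ + K) q N′(u)². Finally Σ_u N′(u)² counts pairs of jobs
-- alive together in S′. Charging each pair to the job j with the larger flow, the jobs charged to j
-- run inside a window of length 3 f′_j, so there are at most 3 K f′_j / q of them, and
-- q Σ_u N′(u)² ≤ 6 K F(S′).

module Submission where

open import Defs
open import Data.Bool using (Bool; true; false; if_then_else_)
open import Data.Empty using (⊥-elim)
open import Data.Fin using (Fin; _≟_) renaming (zero to fzero; suc to fsuc)
open import Data.List using (map; allFin; tabulate)
open import Data.List.Properties using (map-tabulate)
import Data.Nat.ListAction as List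
open import Data.Maybe using (Maybe; just; nothing)
open import Data.Nat hiding (_≟_)
open import Data.Nat.Properties hiding (_≟_)
open import Data.Nat.Tactic.RingSolver using (solve-∀)
open import Data.Product using (Σ; ∃; _×_; _,_)
open import Data.Sum using (_⊎_; inj₁; inj₂)
open import Relation.Nullary using (¬_; Dec; yes; no; _×-dec_)
open import Relation.Nullary.Decidable using (⌊_⌋)
open import Relation.Binary.PropositionalEquality
open import Algebra.Properties.Semiring.Sum +-*-semiring
  using (∑-distrib-+; ∑-comm; *-distribˡ-sum; *-distribʳ-sum; sum-cong-≗; sum-replicate-zero)
  renaming (sum to ∑)

χ : Bool → ℕ
χ b = if b then 1 else 0

𝟙 : ∀ {P : Set} → Dec P → ℕ
𝟙 d = χ ⌊ d ⌋

χ≤1 : ∀ b → χ b ≤ 1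
χ≤1 true  = ≤-refl
χ≤1 false = z≤n

𝟙≤1 : ∀ {P : Set} (d : Dec P) → 𝟙 d ≤ 1
𝟙≤1 d = χ≤1 ⌊ d ⌋

𝟙-yes : ∀ {P : Set} (d : Dec P) → P → 𝟙 d ≡ 1
𝟙-yes (yes _) _ = refl
𝟙-yes (no ¬p) p = ⊥-elim (¬p p)

𝟙-no : ∀ {P : Set} (d : Dec P) → ¬ P → 𝟙 d ≡ 0
𝟙-no (yes p) ¬p = ⊥-elim (¬p p)
𝟙-no (no _)  _  = refl

𝟙*-≤ʳ : ∀ {P : Set} (d : Dec P) x → 𝟙 d * x ≤ x
𝟙*-≤ʳ d x = ≤-trans (*-monoˡ-≤ x (𝟙≤1 d)) (≤-reflexive (*-identityˡ x))

∑-mono-≤ : ∀ {n} {f g : Fin n → ℕ} → (∀ i → f i ≤ g i) → ∑ f ≤ ∑ g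
∑-mono-≤ {zero}  _   = z≤n
∑-mono-≤ {suc n} f≤g = +-mono-≤ (f≤g fzero) (∑-mono-≤ (λ i → f≤g (fsuc i)))

∑-tabulate : ∀ {n} (f : Fin n → ℕ) → List.sum (tabulate f) ≡ ∑ f
∑-tabulate {zero}  f = refl
∑-tabulate {suc n} f = cong (f fzero +_) (∑-tabulate (λ i → f (fsuc i)))

∑-allFin : ∀ {n} (f : Fin n → ℕ) → List.sum (map f (allFin n)) ≡ ∑ f
∑-allFin f = trans (cong List.sum (map-tabulate (λ i → i) f)) (∑-tabulate f)

∑-zero : ∀ {n} {f : Fin n → ℕ} → (∀ i → f i ≡ 0) → ∑ f ≡ 0
∑-zero {n} f≡0 = trans (sum-cong-≗ f≡0) (sum-replicate-zero n)

isJob-just : ∀ {n} (m : Maybe (Fin n)) j → isJob m j ≡ true → m ≡ just j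
isJob-just (just k) j eq with k ≟ j
... | yes refl = refl

isJob-self : ∀ {n} (j : Fin n) → isJob (just j) j ≡ true
isJob-self j with j ≟ j
... | yes _   = refl
... | no j≢j = ⊥-elim (j≢j refl)

isJob-suc : ∀ {n} (k j : Fin n) → isJob (just (fsuc k)) (fsuc j) ≡ isJob (just k) j
isJob-suc k j with k ≟ j
... | yes _ = refl
... | no _  = refl

∑-isJob : ∀ {n} (g : Fin n → ℕ) k → ∑ (λ j → g j * χ (isJob (just k) j)) ≡ g k
∑-isJob {suc n} g fzero    = trans (cong₂ _+_ (*-identityʳ (g fzero)) (∑-zero (λ j → *-zeroʳ (g (fsuc j)))))
                                   (+-identityʳ (g fzero))
∑-isJob {suc n} g (fsuc k) = begin
  g fzero * 0 + ∑ (λ j → g (fsuc j) * χ (isJob (just (fsuc k)) (fsuc j)))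
    ≡⟨ cong₂ _+_ (*-zeroʳ (g fzero)) (sum-cong-≗ (λ j → cong (λ b → g (fsuc j) * χ b) (isJob-suc k j))) ⟩
  ∑ (λ j → g (fsuc j) * χ (isJob (just k) j))
    ≡⟨ ∑-isJob (λ j → g (fsuc j)) k ⟩
  g (fsuc k) ∎
  where open ≡-Reasoning

∑-isJob≤1 : ∀ {n} (m : Maybe (Fin n)) → ∑ (λ j → χ (isJob m j)) ≤ 1
∑-isJob≤1 {n} nothing = ≤-trans (≤-reflexive (∑-zero {n} (λ _ → refl))) z≤n
∑-isJob≤1 (just k) =
  ≤-reflexive (trans (sum-cong-≗ (λ j → sym (*-identityˡ (χ (isJob (just k) j))))) (∑-isJob (λ _ → 1) k))

-- Sums over time slots

∑ᵗ : ℕ → (ℕ → ℕ) → ℕ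
∑ᵗ zero    g = 0
∑ᵗ (suc T) g = g T + ∑ᵗ T g

∑ᵗ-cong : ∀ T {g h : ℕ → ℕ} → (∀ t → t < T → g t ≡ h t) → ∑ᵗ T g ≡ ∑ᵗ T h
∑ᵗ-cong zero    _   = refl
∑ᵗ-cong (suc T) g≡h = cong₂ _+_ (g≡h T ≤-refl) (∑ᵗ-cong T (λ t t<T → g≡h t (m≤n⇒m≤1+n t<T)))

∑ᵗ-mono-≤ : ∀ T {g h : ℕ → ℕ} → (∀ t → t < T → g t ≤ h t) → ∑ᵗ T g ≤ ∑ᵗ T h
∑ᵗ-mono-≤ zero    _   = z≤n
∑ᵗ-mono-≤ (suc T) g≤h = +-mono-≤ (g≤h T ≤-refl) (∑ᵗ-mono-≤ T (λ t t<T → g≤h t (m≤n⇒m≤1+n t<T)))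

∑ᵗ-const : ∀ T c → ∑ᵗ T (λ _ → c) ≡ T * c
∑ᵗ-const zero    c = refl
∑ᵗ-const (suc T) c = cong (c +_) (∑ᵗ-const T c)

∑ᵗ-zero : ∀ T {g : ℕ → ℕ} → (∀ t → g t ≡ 0) → ∑ᵗ T g ≡ 0
∑ᵗ-zero zero    _   = refl
∑ᵗ-zero (suc T) g≡0 = cong₂ _+_ (g≡0 T) (∑ᵗ-zero T g≡0)

∑ᵗ-distrib-+ : ∀ T (g h : ℕ → ℕ) → ∑ᵗ T (λ t → g t + h t) ≡ ∑ᵗ T g + ∑ᵗ T h
∑ᵗ-distrib-+ zero    g h = refl
∑ᵗ-distrib-+ (suc T) g h = trans (cong (g T + h T +_) (∑ᵗ-distrib-+ T g h)) (+-+-comm (g T) (h T) _ _)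
  where
  +-+-comm : ∀ a b c d → a + b + (c + d) ≡ a + c + (b + d)
  +-+-comm = solve-∀

*-distribˡ-∑ᵗ : ∀ T c (g : ℕ → ℕ) → c * ∑ᵗ T g ≡ ∑ᵗ T (λ t → c * g t)
*-distribˡ-∑ᵗ zero    c g = *-zeroʳ c
*-distribˡ-∑ᵗ (suc T) c g = trans (*-distribˡ-+ c (g T) _) (cong (c * g T +_) (*-distribˡ-∑ᵗ T c g))

∑ᵗ-∑-comm : ∀ T {n} (h : ℕ → Fin n → ℕ) → ∑ᵗ T (λ t → ∑ (h t)) ≡ ∑ (λ j → ∑ᵗ T (λ t → h t j))
∑ᵗ-∑-comm zero {n} h = sym (∑-zero {n} (λ _ → refl))
∑ᵗ-∑-comm (suc T) h = trans (cong (∑ (h T) +_) (∑ᵗ-∑-comm T h)) (sym (∑-distrib-+ (h T) _))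

∑ᵗ-split : ∀ a m (g : ℕ → ℕ) → ∑ᵗ (a + m) g ≡ ∑ᵗ m (λ k → g (a + k)) + ∑ᵗ a g
∑ᵗ-split a zero    g = cong (λ T → ∑ᵗ T g) (+-identityʳ a)
∑ᵗ-split a (suc m) g = trans (cong (λ T → ∑ᵗ T g) (+-suc a m))
                             (trans (cong (g (a + m) +_) (∑ᵗ-split a m g)) (sym (+-assoc (g (a + m)) _ _)))

∑ᵗ-monoˡ-≤ : ∀ (g : ℕ → ℕ) {T T′} → T ≤ T′ → ∑ᵗ T g ≤ ∑ᵗ T′ g
∑ᵗ-monoˡ-≤ g {T} {T′} T≤T′ = begin
  ∑ᵗ T g                              ≤⟨ m≤n+m _ _ ⟩
  ∑ᵗ (T′ ∸ T) (λ k → g (T + k)) + ∑ᵗ T g ≡⟨ sym (∑ᵗ-split T (T′ ∸ T) g) ⟩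
  ∑ᵗ (T + (T′ ∸ T)) g                 ≡⟨ cong (λ T″ → ∑ᵗ T″ g) (m+[n∸m]≡n T≤T′) ⟩
  ∑ᵗ T′ g                             ∎
  where open ≤-Reasoning

∑ᵗ-vanishing : ∀ (g : ℕ → ℕ) B → (∀ t → B ≤ t → g t ≡ 0) → ∀ T → ∑ᵗ T g ≤ ∑ᵗ B g
∑ᵗ-vanishing g B g≡0 zero = z≤n
∑ᵗ-vanishing g B g≡0 (suc T) with B ≤? T
... | yes B≤T = ≤-trans (≤-reflexive (cong (_+ ∑ᵗ T g) (g≡0 T B≤T))) (∑ᵗ-vanishing g B g≡0 T)
... | no  B≰T = ∑ᵗ-monoˡ-≤ g (≰⇒> B≰T)

2*∑ᵗ-countdown : ∀ m → 2 * ∑ᵗ m (λ k → m ∸ k) ≡ m * suc m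
2*∑ᵗ-countdown zero    = refl
2*∑ᵗ-countdown (suc m) = begin
  2 * ∑ᵗ (suc m) (λ k → suc m ∸ k)        ≡⟨ cong (λ x → 2 * (x + ∑ᵗ m (λ k → suc m ∸ k))) (m+n∸n≡m 1 m) ⟩
  2 * (1 + ∑ᵗ m (λ k → suc m ∸ k))        ≡⟨ cong (λ x → 2 * (1 + x)) countdown-suc ⟩
  2 * (1 + (∑ᵗ m (λ k → m ∸ k) + m))      ≡⟨ distribute m _ ⟩
  2 * ∑ᵗ m (λ k → m ∸ k) + 2 * suc m      ≡⟨ cong (_+ 2 * suc m) (2*∑ᵗ-countdown m) ⟩
  m * suc m + 2 * suc m                   ≡⟨ square m ⟩
  suc m * suc (suc m)                     ∎
  where
  open ≡-Reasoning
  distribute : ∀ m S → 2 * (1 + (S + m)) ≡ 2 * S + 2 * suc m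
  distribute = solve-∀
  square : ∀ m → m * suc m + 2 * suc m ≡ suc m * suc (suc m)
  square = solve-∀
  countdown-suc : ∑ᵗ m (λ k → suc m ∸ k) ≡ ∑ᵗ m (λ k → m ∸ k) + m
  countdown-suc = begin
    ∑ᵗ m (λ k → suc m ∸ k)                 ≡⟨ ∑ᵗ-cong m (λ k k<m → +-∸-assoc 1 (<⇒≤ k<m)) ⟩
    ∑ᵗ m (λ k → 1 + (m ∸ k))               ≡⟨ ∑ᵗ-distrib-+ m (λ _ → 1) (λ k → m ∸ k) ⟩
    ∑ᵗ m (λ _ → 1) + ∑ᵗ m (λ k → m ∸ k)    ≡⟨ cong (_+ ∑ᵗ m (λ k → m ∸ k)) (trans (∑ᵗ-const m 1) (*-identityʳ m)) ⟩
    m + ∑ᵗ m (λ k → m ∸ k)                 ≡⟨ +-comm m _ ⟩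
    ∑ᵗ m (λ k → m ∸ k) + m                 ∎

𝟙[_,_⟩ : ℕ → ℕ → ℕ → ℕ
𝟙[ a , b ⟩ u = 𝟙 (a ≤? u ×-dec u <? b)

𝟙[_,∞⟩ : ℕ → ℕ → ℕ
𝟙[ a ,∞⟩ u = 𝟙 (a ≤? u)

𝟙[⟩-inside : ∀ a b {u} → a ≤ u → u < b → 𝟙[ a , b ⟩ u ≡ 1
𝟙[⟩-inside a b {u} a≤u u<b = 𝟙-yes (a ≤? u ×-dec u <? b) (a≤u , u<b)

𝟙[⟩-below : ∀ a b {u} → u < a → 𝟙[ a , b ⟩ u ≡ 0
𝟙[⟩-below a b {u} u<a = 𝟙-no (a ≤? u ×-dec u <? b) λ (a≤u , _) → <⇒≱ u<a a≤u

𝟙[⟩-above : ∀ a b {u} → b ≤ u → 𝟙[ a , b ⟩ u ≡ 0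
𝟙[⟩-above a b {u} b≤u = 𝟙-no (a ≤? u ×-dec u <? b) λ (_ , u<b) → <⇒≱ u<b b≤u

𝟙[,∞⟩-inside : ∀ a {u} → a ≤ u → 𝟙[ a ,∞⟩ u ≡ 1
𝟙[,∞⟩-inside a {u} = 𝟙-yes (a ≤? u)

𝟙[,∞⟩-below : ∀ a {u} → u < a → 𝟙[ a ,∞⟩ u ≡ 0
𝟙[,∞⟩-below a {u} u<a = 𝟙-no (a ≤? u) (<⇒≱ u<a)

𝟙[⟩-disjoint : ∀ {a b a′ b′} → b ≤ a′ → ∀ u → 𝟙[ a , b ⟩ u * 𝟙[ a′ , b′ ⟩ u ≡ 0
𝟙[⟩-disjoint {a} {b} {a′} {b′} b≤a′ u with <-≤-connex u b
... | inj₁ u<b = trans (cong (𝟙[ a , b ⟩ u *_) (𝟙[⟩-below a′ b′ (<-≤-trans u<b b≤a′))) (*-zeroʳ (𝟙[ a , b ⟩ u))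
... | inj₂ b≤u = cong (_* 𝟙[ a′ , b′ ⟩ u) (𝟙[⟩-above a b b≤u)

∑ᵗ-𝟙[a,b⟩≤T∸a : ∀ T a b → ∑ᵗ T 𝟙[ a , b ⟩ ≤ T ∸ a
∑ᵗ-𝟙[a,b⟩≤T∸a zero    a b = z≤n
∑ᵗ-𝟙[a,b⟩≤T∸a (suc T) a b with ≤-<-connex a T
... | inj₁ a≤T = begin
  𝟙[ a , b ⟩ T + ∑ᵗ T 𝟙[ a , b ⟩  ≤⟨ +-mono-≤ (𝟙≤1 (a ≤? T ×-dec T <? b)) (∑ᵗ-𝟙[a,b⟩≤T∸a T a b) ⟩
  1 + (T ∸ a)                     ≡⟨ +-∸-assoc 1 a≤T ⟨
  suc T ∸ a                       ∎
  where open ≤-Reasoning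
... | inj₂ T<a = begin
  𝟙[ a , b ⟩ T + ∑ᵗ T 𝟙[ a , b ⟩  ≡⟨ cong (_+ ∑ᵗ T 𝟙[ a , b ⟩) (𝟙[⟩-below a b T<a) ⟩
  ∑ᵗ T 𝟙[ a , b ⟩                 ≤⟨ ∑ᵗ-𝟙[a,b⟩≤T∸a T a b ⟩
  T ∸ a                           ≤⟨ ∸-monoˡ-≤ a (n≤1+n T) ⟩
  suc T ∸ a                       ∎
  where open ≤-Reasoning

∑ᵗ-𝟙[a,b⟩≤b∸a : ∀ T a b → ∑ᵗ T 𝟙[ a , b ⟩ ≤ b ∸ a
∑ᵗ-𝟙[a,b⟩≤b∸a T a b = ≤-trans (∑ᵗ-vanishing 𝟙[ a , b ⟩ b (λ _ → 𝟙[⟩-above a b) T) (∑ᵗ-𝟙[a,b⟩≤T∸a b a b)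

[b∸a]²≤2*∑ᵗ-countdown : ∀ {a b} T → a ≤ b → b ≤ T →
                            (b ∸ a) * (b ∸ a) ≤ 2 * ∑ᵗ T (λ u → 𝟙[ a , b ⟩ u * (b ∸ u))
[b∸a]²≤2*∑ᵗ-countdown {a} {b} T a≤b b≤T = begin
  m * m                                      ≤⟨ *-monoʳ-≤ m (n≤1+n m) ⟩
  m * suc m                                  ≡⟨ 2*∑ᵗ-countdown m ⟨
  2 * ∑ᵗ m (λ k → m ∸ k)                     ≡⟨ cong (2 *_) (∑ᵗ-cong m inside) ⟨
  2 * ∑ᵗ m (λ k → g (a + k))                 ≤⟨ *-monoʳ-≤ 2 (m≤m+n (∑ᵗ m (λ k → g (a + k))) (∑ᵗ a g)) ⟩
  2 * (∑ᵗ m (λ k → g (a + k)) + ∑ᵗ a g)      ≡⟨ cong (2 *_) (∑ᵗ-split a m g) ⟨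
  2 * ∑ᵗ (a + m) g                           ≡⟨ cong (λ x → 2 * ∑ᵗ x g) (m+[n∸m]≡n a≤b) ⟩
  2 * ∑ᵗ b g                                 ≤⟨ *-monoʳ-≤ 2 (∑ᵗ-monoˡ-≤ g b≤T) ⟩
  2 * ∑ᵗ T g                                 ∎
  where
  open ≤-Reasoning
  m = b ∸ a
  g = λ u → 𝟙[ a , b ⟩ u * (b ∸ u)
  inside : ∀ k → k < m → g (a + k) ≡ m ∸ k
  inside k k<m = begin-equality
    𝟙[ a , b ⟩ (a + k) * (b ∸ (a + k))  ≡⟨ cong (_* (b ∸ (a + k))) (𝟙[⟩-inside a b (m≤m+n a k) a+k<b) ⟩
    1 * (b ∸ (a + k))                  ≡⟨ *-identityˡ _ ⟩
    b ∸ (a + k)                        ≡⟨ ∸-+-assoc b a k ⟨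
    m ∸ k                              ∎
    where
    a+k<b : a + k < b
    a+k<b = ≤-trans (+-monoʳ-< a k<m) (≤-reflexive (m+[n∸m]≡n a≤b))

slotCount≡∑ᵗ : ∀ {n} (σ : ℕ → Maybe (Fin n)) j T → slotCount σ j T ≡ ∑ᵗ T (λ t → χ (isJob (σ t) j))
slotCount≡∑ᵗ σ j zero    = refl
slotCount≡∑ᵗ σ j (suc T) = cong (χ (isJob (σ T) j) +_) (slotCount≡∑ᵗ σ j T)

module _ {n : ℕ} (σ : ℕ → Maybe (Fin n)) where

  slotCount-mono : ∀ j {u v} → u ≤ v → slotCount σ j u ≤ slotCount σ j v
  slotCount-mono j {u} {v} u≤v = begin
    slotCount σ j u                   ≡⟨ slotCount≡∑ᵗ σ j u ⟩
    ∑ᵗ u (λ t → χ (isJob (σ t) j))    ≤⟨ ∑ᵗ-monoˡ-≤ _ u≤v ⟩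
    ∑ᵗ v (λ t → χ (isJob (σ t) j))    ≡⟨ slotCount≡∑ᵗ σ j v ⟨
    slotCount σ j v                   ∎
    where open ≤-Reasoning

  slotCount≤ : ∀ j T → slotCount σ j T ≤ T
  slotCount≤ j zero    = z≤n
  slotCount≤ j (suc T) = +-mono-≤ (χ≤1 (isJob (σ T) j)) (slotCount≤ j T)

  ∑-slotCount≤ : ∀ T → ∑ (λ j → slotCount σ j T) ≤ T
  ∑-slotCount≤ zero    = ≤-reflexive (∑-zero {n} λ _ → refl)
  ∑-slotCount≤ (suc T) = begin
    ∑ (λ j → χ (isJob (σ T) j) + slotCount σ j T)              ≡⟨ ∑-distrib-+ (λ j → χ (isJob (σ T) j)) _ ⟩
    ∑ (λ j → χ (isJob (σ T) j)) + ∑ (λ j → slotCount σ j T)    ≤⟨ +-mono-≤ (∑-isJob≤1 (σ T)) (∑-slotCount≤ T) ⟩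
    suc T                                                      ∎
    where open ≤-Reasoning

  slotCount-split : ∀ j a m → slotCount σ j (a + m) ≡ slotCount (λ k → σ (a + k)) j m + slotCount σ j a
  slotCount-split j a m = begin
    slotCount σ j (a + m)                                           ≡⟨ slotCount≡∑ᵗ σ j (a + m) ⟩
    ∑ᵗ (a + m) (λ t → χ (isJob (σ t) j))                            ≡⟨ ∑ᵗ-split a m _ ⟩
    ∑ᵗ m (λ k → χ (isJob (σ (a + k)) j)) + ∑ᵗ a (λ t → χ (isJob (σ t) j))
                                                                    ≡⟨ cong₂ _+_ (slotCount≡∑ᵗ _ j m) (slotCount≡∑ᵗ σ j a) ⟨
    slotCount (λ k → σ (a + k)) j m + slotCount σ j a ∎
    where open ≡-Reasoning

  slotCount-positive : ∀ j u → 1 ≤ slotCount σ j u → ∃ λ t → t < u × σ t ≡ just j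
  slotCount-positive j (suc u) pos with isJob (σ u) j in eq
  ... | true  = u , ≤-refl , isJob-just (σ u) j eq
  ... | false with slotCount-positive j u pos
  ...   | t , t<u , σt = t , m≤n⇒m≤1+n t<u , σt

  lastEnd≤ : ∀ j T → lastEnd σ j T ≤ T
  lastEnd≤ j zero    = z≤n
  lastEnd≤ j (suc T) with isJob (σ T) j
  ... | true  = ≤-refl
  ... | false = m≤n⇒m≤1+n (lastEnd≤ j T)

  slotCount-lastEnd : ∀ j T → slotCount σ j (lastEnd σ j T) ≡ slotCount σ j T
  slotCount-lastEnd j zero    = refl
  slotCount-lastEnd j (suc T) with isJob (σ T) j in eq
  ... | true  = cong (λ b → χ b + slotCount σ j T) eq
  ... | false = slotCount-lastEnd j T

  lastEnd-slot : ∀ j T → lastEnd σ j T ≡ 0 ⊎ ∃ λ t → lastEnd σ j T ≡ suc t × σ t ≡ just j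
  lastEnd-slot j zero    = inj₁ refl
  lastEnd-slot j (suc T) with isJob (σ T) j in eq
  ... | true  = inj₂ (T , refl , isJob-just (σ T) j eq)
  ... | false = lastEnd-slot j T

releasedWork : ∀ {n} (r p : Fin n → ℕ) → ℕ → ℕ
releasedWork r p u = ∑ λ j → 𝟙[ r j ,∞⟩ u * p j

module _ {n : ℕ} {r p : Fin n → ℕ} (S : Schedule n r p) where
  open Schedule S

  processed : Fin n → ℕ → ℕ
  processed j u = slotCount slot j u

  processedIn : Fin n → ℕ → ℕ → ℕ
  processedIn j a m = slotCount (λ k → slot (a + k)) j m

  processed-+ : ∀ j a m → processed j (a + m) ≡ processedIn j a m + processed j a
  processed-+ j = slotCount-split slot j

  processed-mono : ∀ j {u v} → u ≤ v → processed j u ≤ processed j v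
  processed-mono j = slotCount-mono slot j

  processed-slot : ∀ t j → slot t ≡ just j → 1 ≤ processed j (suc t)
  processed-slot t j slot-t rewrite slot-t | isJob-self j = s≤s z≤n

  processed-from-horizon : ∀ j k → processed j (horizon + k) ≡ p j
  processed-from-horizon j k = begin
    processed j (horizon + k)                         ≡⟨ processed-+ j horizon k ⟩
    processedIn j horizon k + processed j horizon     ≡⟨ cong₂ _+_ nothing-after (amount j) ⟩
    p j                                               ∎
    where
    open ≡-Reasoning
    nothing-after : processedIn j horizon k ≡ 0
    nothing-after = begin
      processedIn j horizon k
        ≡⟨ slotCount≡∑ᵗ _ j k ⟩
      ∑ᵗ k (λ t → χ (isJob (slot (horizon + t)) j))
        ≡⟨ ∑ᵗ-zero k (λ t → cong (λ m → χ (isJob m j)) (idle-after _ (m≤m+n horizon t))) ⟩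
      0 ∎

  processed≤p : ∀ j u → processed j u ≤ p j
  processed≤p j u = ≤-trans (processed-mono j (m≤n+m u horizon)) (≤-reflexive (processed-from-horizon j u))

  processed-completion : ∀ j → processed j (completion S j) ≡ p j
  processed-completion j = trans (slotCount-lastEnd slot j horizon) (amount j)

  processed-after-completion : ∀ j u → completion S j ≤ u → processed j u ≡ p j
  processed-after-completion j u c≤u =
    ≤-antisym (processed≤p j u) (≤-trans (≤-reflexive (sym (processed-completion j))) (processed-mono j c≤u))

  processed-before-release : ∀ j u → u ≤ r j → processed j u ≡ 0
  processed-before-release j zero    _     = refl
  processed-before-release j (suc u) 1+u≤r with isJob (slot u) j in eq
  ... | true  = ⊥-elim (<⇒≱ 1+u≤r (released u j (isJob-just (slot u) j eq)))
  ... | false = processed-before-release j u (<⇒≤ 1+u≤r)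

  processedIn≤ : ∀ j a m → processedIn j a m ≤ p j ∸ processed j a
  processedIn≤ j a m = begin
    processedIn j a m                                  ≡⟨ m+n∸n≡m _ (processed j a) ⟨
    processedIn j a m + processed j a ∸ processed j a  ≡⟨ cong (_∸ processed j a) (processed-+ j a m) ⟨
    processed j (a + m) ∸ processed j a                ≤⟨ ∸-monoˡ-≤ (processed j a) (processed≤p j (a + m)) ⟩
    p j ∸ processed j a                                ∎
    where open ≤-Reasoning

  processedIn-covering : ∀ j a m → a ≤ r j → completion S j ≤ a + m → processedIn j a m ≡ p j
  processedIn-covering j a m a≤r c≤a+m = begin
    processedIn j a m                      ≡⟨ +-identityʳ _ ⟨
    processedIn j a m + 0                  ≡⟨ cong (processedIn j a m +_) (processed-before-release j a a≤r) ⟨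
    processedIn j a m + processed j a      ≡⟨ processed-+ j a m ⟨
    processed j (a + m)                    ≡⟨ processed-after-completion j (a + m) c≤a+m ⟩
    p j                                    ∎
    where open ≡-Reasoning

  processed-before-full-window : ∀ j a m → processedIn j a m ≡ p j → processed j a ≡ 0
  processed-before-full-window j a m full = n≤0⇒n≡0 (+-cancelˡ-≤ (p j) (processed j a) 0 (begin
    p j + processed j a                 ≡⟨ cong (_+ processed j a) full ⟨
    processedIn j a m + processed j a   ≡⟨ processed-+ j a m ⟨
    processed j (a + m)                 ≤⟨ processed≤p j (a + m) ⟩
    p j                                 ≡⟨ +-identityʳ (p j) ⟨
    p j + 0                             ∎))
    where open ≤-Reasoning

  ∑-processedIn≤ : ∀ a m → ∑ (λ j → processedIn j a m) ≤ m
  ∑-processedIn≤ a = ∑-slotCount≤ (λ k → slot (a + k))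

  ∑-*-processedIn : ∀ (w : Fin n → ℕ) a m →
                    ∑ (λ j → w j * processedIn j a m) ≡ ∑ᵗ m (λ k → ∑ (λ j → w j * χ (isJob (slot (a + k)) j)))
  ∑-*-processedIn w a m = begin
    ∑ (λ j → w j * processedIn j a m)
      ≡⟨ sum-cong-≗ (λ j → cong (w j *_) (slotCount≡∑ᵗ _ j m)) ⟩
    ∑ (λ j → w j * ∑ᵗ m (λ k → χ (isJob (slot (a + k)) j)))
      ≡⟨ sum-cong-≗ (λ j → *-distribˡ-∑ᵗ m (w j) _) ⟩
    ∑ (λ j → ∑ᵗ m (λ k → w j * χ (isJob (slot (a + k)) j)))
      ≡⟨ ∑ᵗ-∑-comm m (λ k j → w j * χ (isJob (slot (a + k)) j)) ⟨
    ∑ᵗ m (λ k → ∑ (λ j → w j * χ (isJob (slot (a + k)) j))) ∎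
    where open ≡-Reasoning

  completion≤horizon : ∀ j → completion S j ≤ horizon
  completion≤horizon j = lastEnd≤ slot j horizon

  completion-slot : ∀ j → 1 ≤ p j → ∃ λ t → completion S j ≡ suc t × slot t ≡ just j
  completion-slot j 1≤p with lastEnd-slot slot j horizon
  ... | inj₂ last = last
  ... | inj₁ c≡0  = ⊥-elim (<⇒≱ 1≤p (≤-reflexive (trans (sym (processed-completion j)) (cong (processed j) c≡0))))

  release<completion : ∀ j → 1 ≤ p j → r j < completion S j
  release<completion j 1≤p with completion-slot j 1≤p
  ... | t , c≡1+t , slot-t = ≤-trans (s≤s (released t j slot-t)) (≤-reflexive (sym c≡1+t))

  p≤completion : ∀ j → p j ≤ completion S j
  p≤completion j = ≤-trans (≤-reflexive (sym (processed-completion j))) (slotCount≤ slot j (completion S j))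

  alive : Fin n → ℕ → ℕ
  alive j = 𝟙[ r j , completion S j ⟩

  aliveCount : ℕ → ℕ
  aliveCount u = ∑ λ j → alive j u

  alive-disjoint : ∀ j k → completion S j ≤ r k → ∀ u → alive j u * alive k u ≡ 0
  alive-disjoint j k = 𝟙[⟩-disjoint {r j} {completion S j} {r k} {completion S k}

  pending : Fin n → ℕ → ℕ
  pending j u = 𝟙[ r j ,∞⟩ u * (p j ∸ processed j u)

  pendingWork : ℕ → ℕ
  pendingWork u = ∑ λ j → pending j u

  workDone : ℕ → ℕ
  workDone u = ∑ λ j → processed j u

  workDone-suc : ∀ u → workDone (suc u) ≡ ∑ (λ j → χ (isJob (slot u) j)) + workDone u
  workDone-suc u = ∑-distrib-+ (λ j → χ (isJob (slot u) j)) (λ j → processed j u)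

  workDone≤releasedWork : ∀ u → workDone (suc u) ≤ releasedWork r p u
  workDone≤releasedWork u = ∑-mono-≤ pointwise
    where
    pointwise : ∀ j → processed j (suc u) ≤ 𝟙[ r j ,∞⟩ u * p j
    pointwise j with ≤-<-connex (r j) u
    ... | inj₁ r≤u rewrite 𝟙[,∞⟩-inside (r j) r≤u | *-identityˡ (p j) = processed≤p j (suc u)
    ... | inj₂ u<r rewrite processed-before-release j (suc u) u<r = z≤n

  pendingWork+workDone : ∀ u → pendingWork u + workDone u ≡ releasedWork r p u
  pendingWork+workDone u = trans (sym (∑-distrib-+ (λ j → pending j u) (λ j → processed j u))) (sum-cong-≗ pointwise)
    where
    pointwise : ∀ j → pending j u + processed j u ≡ 𝟙[ r j ,∞⟩ u * p j
    pointwise j with ≤-<-connex (r j) u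
    ... | inj₁ r≤u rewrite 𝟙[,∞⟩-inside (r j) r≤u | *-identityˡ (p j) | *-identityˡ (p j ∸ processed j u) =
      m∸n+n≡m (processed≤p j u)
    ... | inj₂ u<r rewrite 𝟙[,∞⟩-below (r j) u<r = processed-before-release j u (<⇒≤ u<r)

  pendingWork≤ : ∀ B → (∀ j → p j ≤ B) → ∀ u → pendingWork u ≤ B * aliveCount u
  pendingWork≤ B p≤B u = ≤-trans (∑-mono-≤ pointwise) (≤-reflexive (sym (*-distribˡ-sum B (λ j → alive j u))))
    where
    pointwise : ∀ j → pending j u ≤ B * alive j u
    pointwise j with ≤-<-connex (r j) u | <-≤-connex u (completion S j)
    ... | inj₂ u<r | _        rewrite 𝟙[,∞⟩-below (r j) u<r = z≤n
    ... | inj₁ r≤u | inj₂ c≤u rewrite processed-after-completion j u c≤u | n∸n≡0 (p j) | *-zeroʳ (𝟙[ r j ,∞⟩ u) = z≤n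
    ... | inj₁ r≤u | inj₁ u<c rewrite 𝟙[⟩-inside (r j) (completion S j) r≤u u<c | 𝟙[,∞⟩-inside (r j) r≤u
                                    | *-identityˡ (p j ∸ processed j u) | *-identityʳ B =
      ≤-trans (m∸n≤m (p j) (processed j u)) (p≤B j)

-- First-Come-First-Served

module _ {n : ℕ} {r p : Fin n → ℕ} (S : Schedule n r p) (fcfs : IsFCFS S) where
  open Schedule S
  open IsFCFS fcfs

  fcfs-run : ∀ j → processedIn S j (completion S j ∸ p j) (p j) ≡ p j
  fcfs-run j = begin
    processedIn S j start (p j)                      ≡⟨ slotCount≡∑ᵗ _ j (p j) ⟩
    ∑ᵗ (p j) (λ k → χ (isJob (slot (start + k)) j))  ≡⟨ ∑ᵗ-cong (p j) in-run ⟩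
    ∑ᵗ (p j) (λ _ → 1)                               ≡⟨ ∑ᵗ-const (p j) 1 ⟩
    p j * 1                                          ≡⟨ *-identityʳ (p j) ⟩
    p j                                              ∎
    where
    open ≡-Reasoning
    start = completion S j ∸ p j
    in-run : ∀ k → k < p j → χ (isJob (slot (start + k)) j) ≡ 1
    in-run k k<p rewrite contiguous j (start + k) (m≤m+n start k)
                           (≤-trans (+-monoʳ-< start k<p) (≤-reflexive (m∸n+n≡m (p≤completion S j))))
                       | isJob-self j = refl

  fcfs-start≤ : ∀ t j → slot t ≡ just j → completion S j ∸ p j ≤ t
  fcfs-start≤ t j slot-t = ≮⇒≥ λ t<start → 1≰0 (begin
    1                                     ≤⟨ processed-slot S t j slot-t ⟩
    processed S j (suc t)                 ≤⟨ processed-mono S j t<start ⟩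
    processed S j (completion S j ∸ p j)  ≡⟨ processed-before-full-window S j _ (p j) (fcfs-run j) ⟩
    0                                     ∎)
    where
    open ≤-Reasoning
    1≰0 : ¬ 1 ≤ 0
    1≰0 ()

  -- A job released after r i could only start after c i, and FCFS does not idle while i waits.
  fcfs-slot-released : ∀ i u t → r i ≤ u → u ≤ t → t < completion S i →
                       1 ≤ ∑ (λ j → 𝟙[ r j ,∞⟩ u * χ (isJob (slot t) j))
  fcfs-slot-released i u t r≤u u≤t t<c with slot t in slot-t
  ... | nothing = ⊥-elim (<⇒≱ t<c (non-idling t slot-t i (≤-trans r≤u u≤t)))
  ... | just k with r i <? r k
  ...   | yes rᵢ<rₖ = ⊥-elim (<⇒≱ t<c (≤-trans (ordered i k rᵢ<rₖ) (fcfs-start≤ t k slot-t)))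
  ...   | no  rᵢ≮rₖ = ≤-reflexive (sym (trans (∑-isJob (λ j → 𝟙[ r j ,∞⟩ u) k)
                                               (𝟙[,∞⟩-inside (r k) (≤-trans (≮⇒≥ rᵢ≮rₖ) r≤u))))

  fcfs-remaining≤pendingWork : ∀ i u → r i ≤ u → u < completion S i → completion S i ∸ u ≤ pendingWork S u
  fcfs-remaining≤pendingWork i u r≤u u<c = begin
    m
      ≡⟨ trans (∑ᵗ-const m 1) (*-identityʳ m) ⟨
    ∑ᵗ m (λ _ → 1)
      ≤⟨ ∑ᵗ-mono-≤ m occupied ⟩
    ∑ᵗ m (λ k → ∑ (λ j → 𝟙[ r j ,∞⟩ u * χ (isJob (slot (u + k)) j)))
      ≡⟨ ∑-*-processedIn S (λ j → 𝟙[ r j ,∞⟩ u) u m ⟨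
    ∑ (λ j → 𝟙[ r j ,∞⟩ u * processedIn S j u m)
      ≤⟨ ∑-mono-≤ (λ j → *-monoʳ-≤ (𝟙[ r j ,∞⟩ u) (processedIn≤ S j u m)) ⟩
    pendingWork S u ∎
    where
    open ≤-Reasoning
    m = completion S i ∸ u
    occupied : ∀ k → k < m → 1 ≤ ∑ (λ j → 𝟙[ r j ,∞⟩ u * χ (isJob (slot (u + k)) j))
    occupied k k<m = fcfs-slot-released i u (u + k) r≤u (m≤m+n u k)
                       (≤-trans (+-monoʳ-< u k<m) (≤-reflexive (m+[n∸m]≡n (<⇒≤ u<c))))

  -- Only the job in slot u ∸ 1 can be alive and partially processed; every other alive job
  -- still has all of its p j ≥ q / K pending.
  fcfs-aliveCount≤ : ∀ K q → (∀ j → q ≤ K * p j) → ∀ u → q * aliveCount S u ≤ K * pendingWork S u + q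
  fcfs-aliveCount≤ K q q≤Kp u = begin
    q * aliveCount S u
      ≡⟨ *-distribˡ-sum q (λ j → alive S j u) ⟩
    ∑ (λ j → q * alive S j u)
      ≤⟨ ∑-mono-≤ pointwise ⟩
    ∑ (λ j → K * pending S j u + q * running j)
      ≡⟨ ∑-distrib-+ (λ j → K * pending S j u) (λ j → q * running j) ⟩
    ∑ (λ j → K * pending S j u) + ∑ (λ j → q * running j)
      ≡⟨ cong₂ _+_ (*-distribˡ-sum K (λ j → pending S j u)) (*-distribˡ-sum q running) ⟨
    K * pendingWork S u + q * ∑ running
      ≤⟨ +-monoʳ-≤ (K * pendingWork S u) (*-monoʳ-≤ q (∑-isJob≤1 (slot (pred u)))) ⟩
    K * pendingWork S u + q * 1
      ≡⟨ cong (K * pendingWork S u +_) (*-identityʳ q) ⟩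
    K * pendingWork S u + q ∎
    where
    open ≤-Reasoning
    running : Fin n → ℕ
    running j = χ (isJob (slot (pred u)) j)
    pointwise : ∀ j → q * alive S j u ≤ K * pending S j u + q * running j
    pointwise j with ≤-<-connex (r j) u | <-≤-connex u (completion S j)
    ... | inj₂ u<r | _        rewrite 𝟙[⟩-below (r j) (completion S j) u<r | *-zeroʳ q = z≤n
    ... | inj₁ _   | inj₂ c≤u rewrite 𝟙[⟩-above (r j) (completion S j) c≤u | *-zeroʳ q = z≤n
    ... | inj₁ r≤u | inj₁ u<c rewrite 𝟙[⟩-inside (r j) (completion S j) r≤u u<c
                                    | 𝟙[,∞⟩-inside (r j) r≤u
                                    | *-identityʳ q
                                    | *-identityˡ (p j ∸ processed S j u)
                                    with processed S j u in processed≡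
    ...   | zero  = ≤-trans (q≤Kp j) (m≤m+n (K * p j) _)
    ...   | suc _ with slotCount-positive slot j u (≤-trans (s≤s z≤n) (≤-reflexive (sym processed≡)))
    ...     | t , t<u , slot-t
      rewrite contiguous j (pred u) (≤-trans (fcfs-start≤ t j slot-t) (<⇒≤pred t<u)) (≤-<-trans pred[n]≤n u<c)
            | isJob-self j | *-identityʳ q = m≤n+m q _

  fcfs-idle⇒releasedWork≤workDone : ∀ u → slot u ≡ nothing → releasedWork r p u ≤ workDone S u
  fcfs-idle⇒releasedWork≤workDone u idle = ∑-mono-≤ pointwise
    where
    pointwise : ∀ j → 𝟙[ r j ,∞⟩ u * p j ≤ processed S j u
    pointwise j with ≤-<-connex (r j) u
    ... | inj₁ r≤u rewrite 𝟙[,∞⟩-inside (r j) r≤u | *-identityˡ (p j)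
                         | processed-after-completion S j u (non-idling u idle j r≤u) = ≤-refl
    ... | inj₂ u<r rewrite 𝟙[,∞⟩-below (r j) u<r = z≤n

  workDone≤fcfs-workDone : ∀ (S′ : Schedule n r p) u → workDone S′ u ≤ workDone S u
  workDone≤fcfs-workDone S′ zero    = ≤-trans (≤-reflexive (∑-zero {n} λ _ → refl)) z≤n
  workDone≤fcfs-workDone S′ (suc u) = begin
    workDone S′ (suc u)                                        ≡⟨ workDone-suc S′ u ⟩
    ∑ (λ j → χ (isJob (Schedule.slot S′ u) j)) + workDone S′ u ≤⟨ step ⟩
    ∑ (λ j → χ (isJob (slot u) j)) + workDone S u              ≡⟨ workDone-suc S u ⟨
    workDone S (suc u)                                         ∎
    where
    open ≤-Reasoning
    step : ∑ (λ j → χ (isJob (Schedule.slot S′ u) j)) + workDone S′ u ≤ ∑ (λ j → χ (isJob (slot u) j)) + workDone S u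
    step with slot u in slot-u
    ... | just k  =
      +-mono-≤ (≤-trans (∑-isJob≤1 (Schedule.slot S′ u)) (≤-reflexive (sym one-job))) (workDone≤fcfs-workDone S′ u)
      where
      one-job : ∑ (λ j → χ (isJob (just k) j)) ≡ 1
      one-job = trans (sum-cong-≗ (λ j → sym (*-identityˡ (χ (isJob (just k) j))))) (∑-isJob (λ _ → 1) k)
    ... | nothing = begin
      ∑ (λ j → χ (isJob (Schedule.slot S′ u) j)) + workDone S′ u
        ≡⟨ workDone-suc S′ u ⟨
      workDone S′ (suc u)
        ≤⟨ workDone≤releasedWork S′ u ⟩
      releasedWork r p u
        ≤⟨ fcfs-idle⇒releasedWork≤workDone u slot-u ⟩
      workDone S u
        ≤⟨ m≤n+m (workDone S u) (∑ {n} (λ j → χ (isJob nothing j))) ⟩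
      ∑ {n} (λ j → χ (isJob nothing j)) + workDone S u ∎

  fcfs-pendingWork≤pendingWork : ∀ (S′ : Schedule n r p) u → pendingWork S u ≤ pendingWork S′ u
  fcfs-pendingWork≤pendingWork S′ u = +-cancelʳ-≤ (workDone S u) (pendingWork S u) (pendingWork S′ u) (begin
    pendingWork S u + workDone S u     ≡⟨ pendingWork+workDone S u ⟩
    releasedWork r p u                 ≡⟨ pendingWork+workDone S′ u ⟨
    pendingWork S′ u + workDone S′ u   ≤⟨ +-monoʳ-≤ (pendingWork S′ u) (workDone≤fcfs-workDone S′ u) ⟩
    pendingWork S′ u + workDone S u    ∎)
    where open ≤-Reasoning

  fcfs-∑-alive-remaining≤ : ∀ u → ∑ (λ i → alive S i u * (completion S i ∸ u)) ≤ aliveCount S u * pendingWork S u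
  fcfs-∑-alive-remaining≤ u = begin
    ∑ (λ i → alive S i u * (completion S i ∸ u))   ≤⟨ ∑-mono-≤ pointwise ⟩
    ∑ (λ i → alive S i u * pendingWork S u)        ≡⟨ *-distribʳ-sum (pendingWork S u) (λ i → alive S i u) ⟨
    aliveCount S u * pendingWork S u               ∎
    where
    open ≤-Reasoning
    pointwise : ∀ i → alive S i u * (completion S i ∸ u) ≤ alive S i u * pendingWork S u
    pointwise i with ≤-<-connex (r i) u | <-≤-connex u (completion S i)
    ... | inj₁ r≤u | inj₁ u<c = *-monoʳ-≤ (alive S i u) (fcfs-remaining≤pendingWork i u r≤u u<c)
    ... | inj₂ u<r | _        rewrite 𝟙[⟩-below (r i) (completion S i) u<r = z≤n
    ... | inj₁ _   | inj₂ c≤u rewrite 𝟙[⟩-above (r i) (completion S i) c≤u = z≤n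

  fcfs-cost≤ : (∀ j → 1 ≤ p j) → cost S ≤ 2 * ∑ᵗ horizon (λ u → aliveCount S u * pendingWork S u)
  fcfs-cost≤ p≥1 = begin
    cost S
      ≡⟨ ∑-allFin (λ i → flow S i * flow S i) ⟩
    ∑ (λ i → flow S i * flow S i)
      ≤⟨ ∑-mono-≤ flow² ⟩
    ∑ (λ i → 2 * ∑ᵗ horizon (λ u → A i u))
      ≡⟨ *-distribˡ-sum 2 (λ i → ∑ᵗ horizon (λ u → A i u)) ⟨
    2 * ∑ (λ i → ∑ᵗ horizon (λ u → A i u))
      ≡⟨ cong (2 *_) (∑ᵗ-∑-comm horizon (λ u i → A i u)) ⟨
    2 * ∑ᵗ horizon (λ u → ∑ (λ i → A i u))
      ≤⟨ *-monoʳ-≤ 2 (∑ᵗ-mono-≤ horizon (λ u _ → fcfs-∑-alive-remaining≤ u)) ⟩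
    2 * ∑ᵗ horizon (λ u → aliveCount S u * pendingWork S u) ∎
    where
    open ≤-Reasoning
    A : Fin n → ℕ → ℕ
    A i u = alive S i u * (completion S i ∸ u)
    flow² : ∀ i → flow S i * flow S i ≤ 2 * ∑ᵗ horizon (λ u → A i u)
    flow² i = [b∸a]²≤2*∑ᵗ-countdown horizon (<⇒≤ (release<completion S i (p≥1 i))) (completion≤horizon S i)

-- Overlapping jobs in an arbitrary schedule

module _ {n : ℕ} {r p : Fin n → ℕ} (S : Schedule n r p) (p≥1 : ∀ j → 1 ≤ p j) where
  open Schedule S

  private
    c f : Fin n → ℕ
    c = completion S
    f = flow S

  completion≡flow+release : ∀ j → c j ≡ f j + r j
  completion≡flow+release j = sym (m∸n+n≡m (<⇒≤ (release<completion S j (p≥1 j))))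

  ShorterOverlap : Fin n → Fin n → Set
  ShorterOverlap j k = f k ≤ f j × r k < c j × r j < c k

  shorterOverlap? : ∀ j k → Dec (ShorterOverlap j k)
  shorterOverlap? j k = f k ≤? f j ×-dec r k <? c j ×-dec r j <? c k

  shorterOverlap : Fin n → Fin n → ℕ
  shorterOverlap j k = 𝟙 (shorterOverlap? j k)

  ∑ᵗ-alive*alive≤flow : ∀ T j k → ∑ᵗ T (λ u → alive S j u * alive S k u) ≤ f k
  ∑ᵗ-alive*alive≤flow T j k = begin
    ∑ᵗ T (λ u → alive S j u * alive S k u)  ≤⟨ ∑ᵗ-mono-≤ T (λ u _ → 𝟙*-≤ʳ (r j ≤? u ×-dec u <? c j) (alive S k u)) ⟩
    ∑ᵗ T (alive S k)                        ≤⟨ ∑ᵗ-𝟙[a,b⟩≤b∸a T (r k) (c k) ⟩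
    f k                                     ∎
    where open ≤-Reasoning

  ∑ᵗ-alive*alive-comm : ∀ T j k → ∑ᵗ T (λ u → alive S j u * alive S k u) ≡ ∑ᵗ T (λ u → alive S k u * alive S j u)
  ∑ᵗ-alive*alive-comm T j k = ∑ᵗ-cong T (λ u _ → *-comm (alive S j u) (alive S k u))

  ∑ᵗ-alive*alive≤ : ∀ T j k → ∑ᵗ T (λ u → alive S j u * alive S k u) ≤ shorterOverlap j k * f k + shorterOverlap k j * f j
  ∑ᵗ-alive*alive≤ T j k with <-≤-connex (r k) (c j) | <-≤-connex (r j) (c k)
  ... | inj₂ cⱼ≤rₖ | _ = ≤-trans (≤-reflexive (∑ᵗ-zero T (alive-disjoint S j k cⱼ≤rₖ))) z≤n
  ... | inj₁ _ | inj₂ cₖ≤rⱼ =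
    ≤-trans (≤-reflexive (trans (∑ᵗ-alive*alive-comm T j k) (∑ᵗ-zero T (alive-disjoint S k j cₖ≤rⱼ)))) z≤n
  ... | inj₁ rₖ<cⱼ | inj₁ rⱼ<cₖ with ≤-total (f k) (f j)
  ...   | inj₁ fₖ≤fⱼ rewrite 𝟙-yes (shorterOverlap? j k) (fₖ≤fⱼ , rₖ<cⱼ , rⱼ<cₖ) | *-identityˡ (f k) =
    ≤-trans (∑ᵗ-alive*alive≤flow T j k) (m≤m+n (f k) _)
  ...   | inj₂ fⱼ≤fₖ rewrite 𝟙-yes (shorterOverlap? k j) (fⱼ≤fₖ , rⱼ<cₖ , rₖ<cⱼ) | *-identityˡ (f j) =
    ≤-trans (≤-reflexive (∑ᵗ-alive*alive-comm T j k)) (≤-trans (∑ᵗ-alive*alive≤flow T k j) (m≤n+m (f j) _))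

  -- A job k with f k ≤ f j overlapping j is released after r j ∸ f j and completes by c j + f j = r j + 2 f j.
  shorterOverlap-window : ∀ j k → shorterOverlap j k * p k ≤ processedIn S k (r j ∸ f j) (3 * f j)
  shorterOverlap-window j k = go (shorterOverlap? j k)
    where
    go : (d : Dec (ShorterOverlap j k)) → 𝟙 d * p k ≤ processedIn S k (r j ∸ f j) (3 * f j)
    go (no _) = z≤n
    go (yes (fₖ≤fⱼ , rₖ<cⱼ , rⱼ<cₖ)) =
      ≤-reflexive (trans (*-identityˡ (p k)) (sym (processedIn-covering S k (r j ∸ f j) (3 * f j) start≤rₖ cₖ≤end)))
      where
      open ≤-Reasoning
      start≤rₖ : r j ∸ f j ≤ r k
      start≤rₖ = begin
        r j ∸ f j          ≤⟨ ∸-monoˡ-≤ (f j) (<⇒≤ rⱼ<cₖ) ⟩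
        c k ∸ f j          ≡⟨ cong (_∸ f j) (completion≡flow+release k) ⟩
        f k + r k ∸ f j    ≤⟨ ∸-monoˡ-≤ (f j) (+-monoˡ-≤ (r k) fₖ≤fⱼ) ⟩
        f j + r k ∸ f j    ≡⟨ m+n∸m≡n (f j) (r k) ⟩
        r k                ∎
      cₖ≤end : c k ≤ r j ∸ f j + 3 * f j
      cₖ≤end = begin
        c k                                  ≡⟨ completion≡flow+release k ⟩
        f k + r k                            ≤⟨ +-mono-≤ fₖ≤fⱼ (<⇒≤ rₖ<cⱼ) ⟩
        f j + c j                            ≡⟨ cong (f j +_) (completion≡flow+release j) ⟩
        f j + (f j + r j)                    ≤⟨ +-monoʳ-≤ (f j) (+-monoʳ-≤ (f j) (m≤n+m∸n (r j) (f j))) ⟩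
        f j + (f j + (f j + (r j ∸ f j)))    ≡⟨ rearrange (f j) (r j ∸ f j) ⟩
        r j ∸ f j + 3 * f j                  ∎
        where
        rearrange : ∀ x y → x + (x + (x + y)) ≡ y + 3 * x
        rearrange = solve-∀

  q*∑-shorterOverlap≤ : ∀ K q → (∀ k → q ≤ K * p k) → ∀ j → q * ∑ (shorterOverlap j) ≤ K * (3 * f j)
  q*∑-shorterOverlap≤ K q q≤Kp j = begin
    q * ∑ (shorterOverlap j)
      ≡⟨ *-distribˡ-sum q (shorterOverlap j) ⟩
    ∑ (λ k → q * shorterOverlap j k)
      ≤⟨ ∑-mono-≤ (λ k → *-monoˡ-≤ (shorterOverlap j k) (q≤Kp k)) ⟩
    ∑ (λ k → K * p k * shorterOverlap j k)
      ≡⟨ sum-cong-≗ (λ k → trans (*-assoc K (p k) _) (cong (K *_) (*-comm (p k) _))) ⟩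
    ∑ (λ k → K * (shorterOverlap j k * p k))
      ≡⟨ *-distribˡ-sum K (λ k → shorterOverlap j k * p k) ⟨
    K * ∑ (λ k → shorterOverlap j k * p k)
      ≤⟨ *-monoʳ-≤ K (∑-mono-≤ (shorterOverlap-window j)) ⟩
    K * ∑ (λ k → processedIn S k (r j ∸ f j) (3 * f j))
      ≤⟨ *-monoʳ-≤ K (∑-processedIn≤ S (r j ∸ f j) (3 * f j)) ⟩
    K * (3 * f j) ∎
    where open ≤-Reasoning

  shorterOverlap-flow≤ : ∀ j k → shorterOverlap j k * f k ≤ shorterOverlap j k * f j
  shorterOverlap-flow≤ j k = go (shorterOverlap? j k)
    where
    go : (d : Dec (ShorterOverlap j k)) → 𝟙 d * f k ≤ 𝟙 d * f j
    go (no _)              = z≤n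
    go (yes (fₖ≤fⱼ , _)) = *-monoʳ-≤ 1 fₖ≤fⱼ

  q*∑-shorterOverlap-flow≤ : ∀ K q → (∀ k → q ≤ K * p k) → ∀ j →
                             q * ∑ (λ k → shorterOverlap j k * f k) ≤ f j * (K * (3 * f j))
  q*∑-shorterOverlap-flow≤ K q q≤Kp j = begin
    q * ∑ (λ k → shorterOverlap j k * f k)   ≤⟨ *-monoʳ-≤ q (∑-mono-≤ (shorterOverlap-flow≤ j)) ⟩
    q * ∑ (λ k → shorterOverlap j k * f j)   ≡⟨ cong (q *_) (*-distribʳ-sum (f j) (shorterOverlap j)) ⟨
    q * (∑ (shorterOverlap j) * f j)         ≡⟨ rearrange q (∑ (shorterOverlap j)) (f j) ⟩
    f j * (q * ∑ (shorterOverlap j))         ≤⟨ *-monoʳ-≤ (f j) (q*∑-shorterOverlap≤ K q q≤Kp j) ⟩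
    f j * (K * (3 * f j))                    ∎
    where
    open ≤-Reasoning
    rearrange : ∀ x y z → x * (y * z) ≡ z * (x * y)
    rearrange = solve-∀

  aliveCount² : ∀ u → aliveCount S u * aliveCount S u ≡ ∑ (λ j → ∑ (λ k → alive S j u * alive S k u))
  aliveCount² u = trans (*-distribʳ-sum (aliveCount S u) (λ j → alive S j u))
                        (sum-cong-≗ (λ j → *-distribˡ-sum (alive S j u) (λ k → alive S k u)))

  ∑ᵗ-aliveCount²≤ : ∀ T → ∑ᵗ T (λ u → aliveCount S u * aliveCount S u) ≤ 2 * ∑ (λ j → ∑ (λ k → shorterOverlap j k * f k))
  ∑ᵗ-aliveCount²≤ T = begin
    ∑ᵗ T (λ u → aliveCount S u * aliveCount S u)
      ≡⟨ ∑ᵗ-cong T (λ u _ → aliveCount² u) ⟩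
    ∑ᵗ T (λ u → ∑ (λ j → ∑ (λ k → alive S j u * alive S k u)))
      ≡⟨ ∑ᵗ-∑-comm T (λ u j → ∑ (λ k → alive S j u * alive S k u)) ⟩
    ∑ (λ j → ∑ᵗ T (λ u → ∑ (λ k → alive S j u * alive S k u)))
      ≡⟨ sum-cong-≗ (λ j → ∑ᵗ-∑-comm T (λ u k → alive S j u * alive S k u)) ⟩
    ∑ (λ j → ∑ (λ k → ∑ᵗ T (λ u → alive S j u * alive S k u)))
      ≤⟨ ∑-mono-≤ (λ j → ∑-mono-≤ (∑ᵗ-alive*alive≤ T j)) ⟩
    ∑ (λ j → ∑ (λ k → G j k + G k j))
      ≡⟨ sum-cong-≗ (λ j → ∑-distrib-+ (G j) (λ k → G k j)) ⟩
    ∑ (λ j → ∑ (G j) + ∑ (λ k → G k j))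
      ≡⟨ ∑-distrib-+ (λ j → ∑ (G j)) (λ j → ∑ (λ k → G k j)) ⟩
    ∑ (λ j → ∑ (G j)) + ∑ (λ j → ∑ (λ k → G k j))
      ≡⟨ cong (∑ (λ j → ∑ (G j)) +_) (∑-comm (λ j k → G k j)) ⟩
    ∑ (λ j → ∑ (G j)) + ∑ (λ k → ∑ (G k))
      ≡⟨ cong (∑ (λ j → ∑ (G j)) +_) (+-identityʳ _) ⟨
    2 * ∑ (λ j → ∑ (G j)) ∎
    where
    open ≤-Reasoning
    G : Fin n → Fin n → ℕ
    G j k = shorterOverlap j k * f k

  q*∑ᵗ-aliveCount²≤ : ∀ K q → (∀ k → q ≤ K * p k) → ∀ T →
                      q * ∑ᵗ T (λ u → aliveCount S u * aliveCount S u) ≤ 6 * K * cost S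
  q*∑ᵗ-aliveCount²≤ K q q≤Kp T = begin
    q * ∑ᵗ T (λ u → aliveCount S u * aliveCount S u)   ≤⟨ *-monoʳ-≤ q (∑ᵗ-aliveCount²≤ T) ⟩
    q * (2 * ∑ X)                                     ≡⟨ *-comm-middle q 2 (∑ X) ⟩
    2 * (q * ∑ X)                                     ≡⟨ cong (2 *_) (*-distribˡ-sum q X) ⟩
    2 * ∑ (λ j → q * X j)                             ≤⟨ *-monoʳ-≤ 2 (∑-mono-≤ (q*∑-shorterOverlap-flow≤ K q q≤Kp)) ⟩
    2 * ∑ (λ j → f j * (K * (3 * f j)))               ≡⟨ cong (2 *_) (sum-cong-≗ (λ j → square-form K (f j))) ⟩
    2 * ∑ (λ j → 3 * K * (f j * f j))                 ≡⟨ cong (2 *_) (*-distribˡ-sum (3 * K) (λ j → f j * f j)) ⟨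
    2 * (3 * K * ∑ (λ j → f j * f j))                 ≡⟨ six K (∑ (λ j → f j * f j)) ⟩
    6 * K * ∑ (λ j → f j * f j)                       ≡⟨ cong (6 * K *_) (∑-allFin (λ j → f j * f j)) ⟨
    6 * K * cost S                                    ∎
    where
    open ≤-Reasoning
    X : Fin n → ℕ
    X j = ∑ (λ k → shorterOverlap j k * f k)
    *-comm-middle : ∀ x y z → x * (y * z) ≡ y * (x * z)
    *-comm-middle = solve-∀
    square-form : ∀ K x → x * (K * (3 * x)) ≡ 3 * K * (x * x)
    square-form = solve-∀
    six : ∀ K y → 2 * (3 * K * y) ≡ 6 * K * y
    six = solve-∀

count*work≤ : ∀ {K q N W N′} → 1 ≤ q → q * N ≤ K * W + q → W ≤ K * q * N′ →
              N * W ≤ (K * K * K + K) * q * (N′ * N′)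
count*work≤ {K} {q} {N} {W} {N′} 1≤q qN≤KW+q W≤KqN′ = *-cancelˡ-≤ q {{>-nonZero 1≤q}} (begin
  q * (N * W)
    ≡⟨ *-assoc q N W ⟨
  q * N * W
    ≤⟨ *-monoˡ-≤ W qN≤KW+q ⟩
  (K * W + q) * W
    ≤⟨ *-mono-≤ (+-monoˡ-≤ q (*-monoʳ-≤ K W≤KqN′)) W≤KqN′ ⟩
  (K * (K * q * N′) + q) * (K * q * N′)
    ≡⟨ expand K q N′ ⟩
  K * K * K * q * q * (N′ * N′) + K * q * q * N′
    ≤⟨ +-monoʳ-≤ (K * K * K * q * q * (N′ * N′)) (*-monoʳ-≤ (K * q * q) (m≤m*m N′)) ⟩
  K * K * K * q * q * (N′ * N′) + K * q * q * (N′ * N′)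
    ≡⟨ collect K q N′ ⟩
  q * ((K * K * K + K) * q * (N′ * N′)) ∎)
  where
  open ≤-Reasoning
  m≤m*m : ∀ m → m ≤ m * m
  m≤m*m zero    = z≤n
  m≤m*m (suc m) = m≤m*n (suc m) (suc m)
  expand : ∀ K q x → (K * (K * q * x) + q) * (K * q * x) ≡ K * K * K * q * q * (x * x) + K * q * q * x
  expand = solve-∀
  collect : ∀ K q x → K * K * K * q * q * (x * x) + K * q * q * (x * x) ≡ q * ((K * K * K + K) * q * (x * x))
  collect = solve-∀

fcfsRatio : ℕ → ℕ
fcfsRatio K = 2 * ((K * K * K + K) * (6 * K))

fcfs-competitive : ∀ {n} {r p : Fin n → ℕ} K q → 1 ≤ q → (∀ j → 1 ≤ p j) →
                   (∀ j → q ≤ K * p j) → (∀ j → p j ≤ K * q) →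
                   (S : Schedule n r p) → IsFCFS S → (S′ : Schedule n r p) →
                   cost S ≤ fcfsRatio K * cost S′
fcfs-competitive K q 1≤q p≥1 q≤Kp p≤Kq S fcfs S′ = begin
  cost S
    ≤⟨ fcfs-cost≤ S fcfs p≥1 ⟩
  2 * ∑ᵗ H (λ u → aliveCount S u * pendingWork S u)
    ≤⟨ *-monoʳ-≤ 2 (∑ᵗ-mono-≤ H (λ u _ → per-slot u)) ⟩
  2 * ∑ᵗ H (λ u → M * q * (N′² u))
    ≡⟨ cong (2 *_) (*-distribˡ-∑ᵗ H (M * q) N′²) ⟨
  2 * (M * q * ∑ᵗ H N′²)
    ≡⟨ cong (2 *_) (*-assoc M q (∑ᵗ H N′²)) ⟩
  2 * (M * (q * ∑ᵗ H N′²))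
    ≤⟨ *-monoʳ-≤ 2 (*-monoʳ-≤ M (q*∑ᵗ-aliveCount²≤ S′ p≥1 K q q≤Kp H)) ⟩
  2 * (M * (6 * K * cost S′))
    ≡⟨ regroup M (6 * K) (cost S′) ⟩
  fcfsRatio K * cost S′ ∎
  where
  open ≤-Reasoning
  H = Schedule.horizon S
  M = K * K * K + K
  N′² : ℕ → ℕ
  N′² u = aliveCount S′ u * aliveCount S′ u
  per-slot : ∀ u → aliveCount S u * pendingWork S u ≤ M * q * N′² u
  per-slot u = count*work≤ {K} {N′ = aliveCount S′ u} 1≤q (fcfs-aliveCount≤ S fcfs K q q≤Kp u)
                 (≤-trans (fcfs-pendingWork≤pendingWork S fcfs S′ u) (pendingWork≤ S′ (K * q) p≤Kq u))
  regroup : ∀ m b x → 2 * (m * (b * x)) ≡ 2 * (m * b) * x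
  regroup = solve-∀

theoremE1 : (K : ℕ) → 1 ≤ K →
    Σ ℕ λ C → ∀ (n : ℕ) (r p : Fin n → ℕ) →
      (∀ i → 1 ≤ p i) →
      (∀ i j → p i ≤ K * p j) →
      (S : Schedule n r p) → IsFCFS S →
      (S' : Schedule n r p) →
      cost S ≤ C * cost S'
theoremE1 K _ = fcfsRatio K , competitive
  where
  competitive : ∀ n (r p : Fin n → ℕ) → (∀ i → 1 ≤ p i) → (∀ i j → p i ≤ K * p j) →
                (S : Schedule n r p) → IsFCFS S → (S′ : Schedule n r p) → cost S ≤ fcfsRatio K * cost S′
  competitive zero    r p _   _    S _    S′ = z≤n
  competitive (suc n) r p p≥1 p≤Kp S fcfs S′ =
    fcfs-competitive K (p fzero) (p≥1 fzero) p≥1 (p≤Kp fzero) (λ j → p≤Kp j fzero) S fcfs S′
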